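{- Let $k$ be a positive integer and $\mathcal C$ a $c$-good $k$-configuration, and let $p$ satisfy $2p+1\le k$. Suppose $\mathcal C$ implies the star $\{x_1+x_2=x_3+x_4=\cdots=x_{2p-1}+x_{2p}\}$ and implies a difference equality $(*)$ in the variables $x_1,\dots,x_{2p+1}$ which contains $x_{2p+1}$. Then every difference equality in the variables $x_1,\dots,x_{2p+1}$ containing $x_{2p+1}$ which is implied by $\mathcal C$ is implied by $(*)$ together with the equations of this star.
   Context: Standing parameters: $\varepsilon,k_0,c$ satisfy $0<\varepsilon\le 1/4096$, $k_0\ge 32/\varepsilon^2$ and $2-\min\{\varepsilon^2/32,\,2/k_0\}\le c\le 2$. All linear equations are over $\mathbb Q$ in variables $x_1,\dots,x_k$, considered up to rearrangement but not scaling; the content of an equation is an expression $*$ with the equation reading $*=0$. Equations are independent if their contents are linearly independent; a collection implies an equation if its content is a $\mathbb Q$-linear combination of the contents of the collection. An equation contains a variable if its coefficient is nonzero. A difference equality is a nontrivial equation $x_{i_1}-x_{i_2}=x_{i_3}-x_{i_4}$ ($i_1,\dots,i_4\in[k]$ not necessarily distinct). A $k$-configuration is a system of difference equalities in $x_1,\dots,x_k$. A collection is valid if it does not imply $x_a=x_b$ for $a\ne b$; collinearity-free if it implies no equation containing exactly three variables; $c$-light if for every $t\ge1$ any $t$ independent equations it implies together contain at least $ct+1$ variables; $c$-good if valid, collinearity-free and $c$-light.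
   Formalization: The standing parameters ε, k₀ and c are rational. -}

module Defs where

open import Data.Nat as ℕ using (ℕ; zero; suc)
open import Data.Fin as Fin using (Fin; toℕ)
open import Data.List using (List; []; _∷_; length; lookup; map; upTo)
open import Data.List.Relation.Unary.All using (All)
open import Data.Rational as ℚ using (ℚ; 0ℚ; 1ℚ; _+_; _*_; _-_; _≤_; _<_; _/_)
open import Data.Integer using (+_)
open import Data.Product using (Σ; ∃; _×_; _,_)
open import Data.Bool using (if_then_else_)
open import Relation.Nullary using (¬_; yes; no)
open import Relation.Nullary.Decidable using (⌊_⌋)
open import Relation.Binary.PropositionalEquality using (_≡_; _≢_)

-- Variables x_1,…,x_k are indexed by Fin k (x_{m+1} ↔ index m).
-- The content of a linear equation in x_1..x_k is its coefficient vector.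
Content : ℕ → Set
Content k = Fin k → ℚ

ℕtoℚ : ℕ → ℚ
ℕtoℚ n = (+ n) / 1

Σᶠ : (n : ℕ) → (Fin n → ℚ) → ℚ
Σᶠ zero    f = 0ℚ
Σᶠ (suc n) f = f Fin.zero + Σᶠ n (λ j → f (Fin.suc j))

countᶠ : (n : ℕ) → (Fin n → Data.Bool.Bool) → ℕ
countᶠ zero    f = zero
countᶠ (suc n) f = (if f Fin.zero then 1 else 0) ℕ.+ countᶠ n (λ j → f (Fin.suc j))
  where open import Data.Bool using (Bool)

linComb : ∀ {k} (L : List (Content k)) → (Fin (length L) → ℚ) → Content k
linComb L a i = Σᶠ (length L) (λ j → a j * lookup L j i)

Implies : ∀ {k} → List (Content k) → Content k → Set
Implies L e = ∃ λ (a : Fin (length L) → ℚ) → ∀ i → e i ≡ linComb L a i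

Independent : ∀ {k} → List (Content k) → Set
Independent L = ∀ (a : Fin (length L) → ℚ) → (∀ i → linComb L a i ≡ 0ℚ) → ∀ j → a j ≡ 0ℚ

IsZero : ∀ {k} → Content k → Set
IsZero e = ∀ i → e i ≡ 0ℚ

δ : ∀ {k} → Fin k → Content k
δ a i = if ⌊ a Fin.≟ i ⌋ then 1ℚ else 0ℚ

-- content of x_{i1} - x_{i2} = x_{i3} - x_{i4}, i.e. x_{i1} - x_{i2} - x_{i3} + x_{i4} = 0
diffContent : ∀ {k} → Fin k → Fin k → Fin k → Fin k → Content k
diffContent i₁ i₂ i₃ i₄ i = ((δ i₁ i - δ i₂ i) - δ i₃ i) + δ i₄ i

IsDiffEq : ∀ {k} → Content k → Set
IsDiffEq {k} e = Σ (Fin k) λ i₁ → Σ (Fin k) λ i₂ → Σ (Fin k) λ i₃ → Σ (Fin k) λ i₄ →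
  (∀ i → e i ≡ diffContent i₁ i₂ i₃ i₄ i) × ¬ IsZero e

Configuration : ℕ → Set
Configuration k = Σ (List (Content k)) λ C → All IsDiffEq C

Contains : ∀ {k} → Content k → Fin k → Set
Contains e i = e i ≢ 0ℚ

numVars : ∀ {k} → List (Content k) → ℕ
numVars {k} L = countᶠ k (λ i → anyNZ L i)
  where
  anyNZ : List (Content k) → Fin k → Data.Bool.Bool
  anyNZ []      i = Data.Bool.false
  anyNZ (e ∷ L) i = Data.Bool.not ⌊ e i ℚ.≟ 0ℚ ⌋ Data.Bool.∨ anyNZ L i

Valid : ∀ {k} → List (Content k) → Set
Valid {k} C = ∀ (a b : Fin k) → a ≢ b → ¬ Implies C (λ i → δ a i - δ b i)

CollinearityFree : ∀ {k} → List (Content k) → Set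
CollinearityFree C = ∀ e → Implies C e → ¬ (numVars (e ∷ []) ≡ 3)

Light : ∀ {k} → ℚ → List (Content k) → Set
Light c C = ∀ (E : List (Content _)) → 1 ℕ.≤ length E → All (Implies C) E → Independent E →
  c * ℕtoℚ (length E) + 1ℚ ≤ ℕtoℚ (numVars E)

Good : ∀ {k} → ℚ → Configuration k → Set
Good c (C , _) = Valid C × CollinearityFree C × Light c C

-- Standing parameters: 0 < ε ≤ 1/4096, k₀ ≥ 32/ε², 2 - min{ε²/32, 2/k₀} ≤ c ≤ 2,
-- written with cleared denominators (equivalent since ε > 0 and hence k₀ > 0).
StandingParams : ℚ → ℚ → ℚ → Set
StandingParams ε k₀ c =
  (0ℚ < ε) × (ε * ℕtoℚ 4096 ≤ 1ℚ) × (ℕtoℚ 32 ≤ k₀ * (ε * ε)) ×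
  ((ℕtoℚ 2 - c) * ℕtoℚ 32 ≤ ε * ε) × ((ℕtoℚ 2 - c) * k₀ ≤ ℕtoℚ 2) × (c ≤ ℕtoℚ 2)

-- coefficient (as a function of the 0-based variable index n) of the j-th star equation
-- x_{2j+1} + x_{2j+2} - x_{2j+3} - x_{2j+4} = 0   (j = 0,…,p-2)
starCoef : ℕ → ℕ → ℚ
starCoef j n with n ℕ.≟ 2 ℕ.* j | n ℕ.≟ suc (2 ℕ.* j) | n ℕ.≟ 2 ℕ.+ 2 ℕ.* j | n ℕ.≟ 3 ℕ.+ 2 ℕ.* j
... | yes _ | _ | _ | _ = 1ℚ
... | no _ | yes _ | _ | _ = 1ℚ
... | no _ | no _ | yes _ | _ = ℚ.- 1ℚ
... | no _ | no _ | no _ | yes _ = ℚ.- 1ℚ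
... | no _ | no _ | no _ | no _ = 0ℚ

-- the star x_1+x_2 = x_3+x_4 = ⋯ = x_{2p-1}+x_{2p}, as its p-1 consecutive equalities
star : ∀ {k} → ℕ → List (Content k)
star p = map (λ j i → starCoef j (toℕ i)) (upTo (p ℕ.∸ 1))

InFirst : ∀ {k} → ℕ → Content k → Set
InFirst m e = ∀ i → m ℕ.≤ toℕ i → e i ≡ 0ℚ

-- e contains the variable x_{m+1} (0-based index m)
ContainsIdx : ∀ {k} → ℕ → Content k → Set
ContainsIdx m e = ∃ λ i → toℕ i ≡ m × Contains e i

-- Write x for x_{2p+1} and eliminate it from (*) and d: f := d(x)·(*) − (*)(x)·d is a consequence
-- of 𝒞 in x_1, …, x_{2p} with at most eight variables. If f had different coefficients on the two
-- variables of some pair {x_{2j+1}, x_{2j+2}} of the star, then f together with the differences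
-- (x_{2m+1} + x_{2m+2}) − (x_{2j+1} + x_{2j+2}) over the other pairs m met by f, which the star implies,
-- would be t ≤ 9 independent consequences of 𝒞 in at most 2t variables; c-lightness forbids this as
-- 2 − c ≤ ε²/32 < 1/9. So f = Σ w_m (x_{2m+1} + x_{2m+2}), which modulo the star is (Σ w_m)(x_1 + x_2),
-- and Σ w_m = 0 since x_1 + x_2 = 0 would violate lightness as well. Hence the star implies f, and
-- f and (*) imply d because (*)(x) ≠ 0.
module Submission where

open import Defs

-- The operators of ℚ are opened only inside this block, as the statement of lemma9p2 uses those of ℕ.
module _ where
  open import Data.Bool using (Bool; true; false; T; not; _∨_; if_then_else_)
  open import Data.Bool.ListAction using (any)
  open import Data.Bool.Properties using (T-≡)
  open import Data.Empty using (⊥; ⊥-elim)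
  open import Data.Fin as Fin using (Fin; toℕ; fromℕ<)
  import Data.Fin.Properties as Finₚ
  import Data.Integer as ℤ
  import Data.Integer.Properties as ℤₚ
  open import Data.List using (List; []; _∷_; _++_; length; lookup; map; filter; deduplicate)
  import Data.List.Properties as Listₚ
  open import Data.List.Membership.Propositional using (_∈_)
  open import Data.List.Membership.Propositional.Properties
    using (∈-map⁺; ∈-upTo⁺; ∈-++⁺ˡ; ∈-++⁺ʳ; ∈-filter⁺; ∈-filter⁻; ∈-deduplicate⁺; ∈-deduplicate⁻)
  open import Data.List.Relation.Unary.All as All using (All; []; _∷_)
  import Data.List.Relation.Unary.All.Properties as Allₚ
  open import Data.List.Relation.Unary.AllPairs using ([]; _∷_)
  open import Data.List.Relation.Unary.Any using (here; there)
  open import Data.List.Relation.Unary.Any.Properties using (any⁻)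
  open import Data.List.Relation.Unary.Unique.Propositional using (Unique)
  open import Data.Nat as ℕ using (ℕ; zero; suc; z≤n; s≤s; ⌊_/2⌋; _≟_)
  import Data.Nat.Properties as ℕₚ
  open import Data.List.Membership.DecPropositional _≟_ using (_∈?_)
  open import Data.List.Relation.Unary.Unique.DecPropositional.Properties _≟_ using (deduplicate-!)
  open import Data.Nat.Coprimality as Coprime using (1-coprimeTo)
  open import Data.Product using (Σ; _×_; _,_; proj₁; proj₂)
  open import Data.Rational as ℚ using (ℚ; 0ℚ; 1ℚ; _+_; _*_; _-_; -_; 1/_; mkℚ; *≤*; _≤_; _<_)
  import Data.Rational.Properties as ℚₚ
  open import Data.Rational.Solver using (module +-*-Solver)
  open import Data.Sum using (_⊎_; inj₁; inj₂; [_,_]′)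
  open import Function using (_∘_; _∘′_)
  open import Function.Bundles using (Equivalence)
  open import Relation.Binary.PropositionalEquality
  open import Relation.Nullary using (¬_; ¬?; _×-dec_; yes; no; does; contradiction)
  open import Relation.Nullary.Decidable using (⌊_⌋; dec-true; dec-false; decidable-stable; toWitness; toWitnessFalse)
  open import Relation.Unary using (Decidable)

  open +-*-Solver using (solve; _:=_; _:+_; _:*_; _:-_; :-_; con)

  -- Linear consequences

  Σᶠ-cong : ∀ n {f g : Fin n → ℚ} → (∀ j → f j ≡ g j) → Σᶠ n f ≡ Σᶠ n g
  Σᶠ-cong zero    f≗g = refl
  Σᶠ-cong (suc n) f≗g = cong₂ _+_ (f≗g Fin.zero) (Σᶠ-cong n (f≗g ∘ Fin.suc))

  Σᶠ-0 : ∀ n → Σᶠ n (λ _ → 0ℚ) ≡ 0ℚ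
  Σᶠ-0 zero    = refl
  Σᶠ-0 (suc n) = trans (cong (0ℚ +_) (Σᶠ-0 n)) (ℚₚ.+-identityˡ 0ℚ)

  Σᶠ-+ : ∀ n (f g : Fin n → ℚ) → Σᶠ n (λ j → f j + g j) ≡ Σᶠ n f + Σᶠ n g
  Σᶠ-+ zero    f g = refl
  Σᶠ-+ (suc n) f g = trans (cong (f Fin.zero + g Fin.zero +_) (Σᶠ-+ n (f ∘ Fin.suc) (g ∘ Fin.suc)))
    (solve 4 (λ a b c d → (a :+ b) :+ (c :+ d) := (a :+ c) :+ (b :+ d)) refl
       (f Fin.zero) (g Fin.zero) (Σᶠ n (f ∘ Fin.suc)) (Σᶠ n (g ∘ Fin.suc)))

  Σᶠ-*ˡ : ∀ n r (f : Fin n → ℚ) → Σᶠ n (λ j → r * f j) ≡ r * Σᶠ n f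
  Σᶠ-*ˡ zero    r f = sym (ℚₚ.*-zeroʳ r)
  Σᶠ-*ˡ (suc n) r f = trans (cong (r * f Fin.zero +_) (Σᶠ-*ˡ n r (f ∘ Fin.suc)))
    (sym (ℚₚ.*-distribˡ-+ r (f Fin.zero) (Σᶠ n (f ∘ Fin.suc))))

  Σᶠ-*ʳ : ∀ n r (f : Fin n → ℚ) → Σᶠ n (λ j → f j * r) ≡ Σᶠ n f * r
  Σᶠ-*ʳ n r f = trans (Σᶠ-cong n (λ j → ℚₚ.*-comm (f j) r)) (trans (Σᶠ-*ˡ n r f) (ℚₚ.*-comm r (Σᶠ n f)))

  -- `Implies L` is not injective in L, so L is a module parameter here rather than an implicit argument.
  module Span {k : ℕ} (L : List (Content k)) where

    Implies-resp : ∀ {g h : Content k} → (∀ i → g i ≡ h i) → Implies L g → Implies L h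
    Implies-resp g≗h (a , g≡) = a , λ i → trans (sym (g≗h i)) (g≡ i)

    Implies-0 : Implies L (λ _ → 0ℚ)
    Implies-0 = (λ _ → 0ℚ) , λ i → sym (trans
      (Σᶠ-cong (length L) (λ j → ℚₚ.*-zeroˡ (lookup L j i))) (Σᶠ-0 (length L)))

    Implies-+ : ∀ {g h : Content k} → Implies L g → Implies L h → Implies L (λ i → g i + h i)
    Implies-+ {g} {h} (a , g≡) (b , h≡) = (λ j → a j + b j) , λ i → begin
      g i + h i                                              ≡⟨ cong₂ _+_ (g≡ i) (h≡ i) ⟩
      linComb L a i + linComb L b i                          ≡⟨ Σᶠ-+ (length L) _ _ ⟨
      Σᶠ (length L) (λ j → a j * l j i + b j * l j i)        ≡⟨ Σᶠ-cong (length L) (λ j → ℚₚ.*-distribʳ-+ (l j i) (a j) (b j)) ⟨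
      Σᶠ (length L) (λ j → (a j + b j) * l j i)              ∎
      where
      open ≡-Reasoning
      l = lookup L

    Implies-* : ∀ {g : Content k} r → Implies L g → Implies L (λ i → r * g i)
    Implies-* r (a , g≡) = (λ j → r * a j) , λ i → sym (trans
      (Σᶠ-cong (length L) (λ j → ℚₚ.*-assoc r (a j) (lookup L j i)))
      (trans (Σᶠ-*ˡ (length L) r _) (cong (r *_) (sym (g≡ i)))))

    Implies-− : ∀ {g h : Content k} → Implies L g → Implies L h → Implies L (λ i → g i - h i)
    Implies-− {g} {h} g∈ h∈ = Implies-resp (λ i → solve 2 (λ x y → x :+ (:- con 1ℚ) :* y := x :- y) refl (g i) (h i))
      (Implies-+ g∈ (Implies-* (- 1ℚ) h∈))

    Implies-Σᶠ : ∀ n {g : Fin n → Content k} → (∀ m → Implies L (g m)) → Implies L (λ i → Σᶠ n (λ m → g m i))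
    Implies-Σᶠ zero    g∈ = Implies-0
    Implies-Σᶠ (suc n) g∈ = Implies-+ (g∈ Fin.zero) (Implies-Σᶠ n (g∈ ∘ Fin.suc))

  module _ {k : ℕ} where

    linComb-agree : ∀ {L : List (Content k)} {x y} → All (λ l → l x ≡ l y) L → ∀ a → linComb L a x ≡ linComb L a y
    linComb-agree []           a = refl
    linComb-agree (lx≡ly ∷ L≡) a = cong₂ _+_ (cong (a Fin.zero *_) lx≡ly) (linComb-agree L≡ (a ∘ Fin.suc))

    linComb-vanish : ∀ {L : List (Content k)} {x} → All (λ l → l x ≡ 0ℚ) L → ∀ a → linComb L a x ≡ 0ℚ
    linComb-vanish             []           a = refl
    linComb-vanish {l ∷ L} {x} (lx≡0 ∷ L≡0) a = begin
      a Fin.zero * l x + linComb L (a ∘ Fin.suc) x ≡⟨ cong₂ (λ u v → a Fin.zero * u + v) lx≡0 (linComb-vanish L≡0 (a ∘ Fin.suc)) ⟩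
      a Fin.zero * 0ℚ + 0ℚ                        ≡⟨ solve 1 (λ u → u :* con 0ℚ :+ con 0ℚ := con 0ℚ) refl (a Fin.zero) ⟩
      0ℚ                                          ∎
      where open ≡-Reasoning

    Implies-agree : ∀ {L : List (Content k)} {g x y} → All (λ l → l x ≡ l y) L → Implies L g → g x ≡ g y
    Implies-agree {x = x} {y} L≡ (a , g≡) = trans (g≡ x) (trans (linComb-agree L≡ a) (sym (g≡ y)))

    Implies-vanish : ∀ {L : List (Content k)} {g x} → All (λ l → l x ≡ 0ℚ) L → Implies L g → g x ≡ 0ℚ
    Implies-vanish {x = x} L≡0 (a , g≡) = trans (g≡ x) (linComb-vanish L≡0 a)

    Implies-here : ∀ {L : List (Content k)} {e} → Implies (e ∷ L) e
    Implies-here {L} {e} = a , λ i → sym (begin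
      1ℚ * e i + Σᶠ (length L) (λ j → 0ℚ * lookup L j i) ≡⟨ cong₂ _+_ (ℚₚ.*-identityˡ (e i))
                                                              (Σᶠ-cong (length L) (λ j → ℚₚ.*-zeroˡ (lookup L j i))) ⟩
      e i + Σᶠ (length L) (λ _ → 0ℚ)                      ≡⟨ cong (e i +_) (Σᶠ-0 (length L)) ⟩
      e i + 0ℚ                                            ≡⟨ ℚₚ.+-identityʳ (e i) ⟩
      e i                                                 ∎)
      where
      open ≡-Reasoning
      a : Fin (suc (length L)) → ℚ
      a Fin.zero    = 1ℚ
      a (Fin.suc _) = 0ℚ

    Implies-∷ : ∀ {L : List (Content k)} {e g} → Implies L g → Implies (e ∷ L) g
    Implies-∷ {L} {e} (a , g≡) = (λ { Fin.zero → 0ℚ ; (Fin.suc j) → a j }) , λ i → trans (g≡ i)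
      (sym (trans (cong (_+ linComb L a i) (ℚₚ.*-zeroˡ (e i))) (ℚₚ.+-identityˡ (linComb L a i))))

    Implies-∈ : ∀ {L : List (Content k)} {g} → g ∈ L → Implies L g
    Implies-∈ {_ ∷ L} (here refl) = Implies-here {L}
    Implies-∈ {e ∷ L} (there g∈L) = Implies-∷ {L} {e} (Implies-∈ g∈L)

    Independent-∷ : ∀ {L : List (Content k)} {e} → ¬ Implies L e → Independent L → Independent (e ∷ L)
    Independent-∷ {L} {e} e∉L L-indep a comb≡0 = λ where
        Fin.zero    → a₀≡0
        (Fin.suc j) → L-indep (a ∘ Fin.suc) tail≡0 j
      where
      open Span L
      a₀ = a Fin.zero
      tail : Content k
      tail = linComb L (a ∘ Fin.suc)
      tail∈L : Implies L tail
      tail∈L = a ∘ Fin.suc , λ i → refl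

      a₀≡0 : a₀ ≡ 0ℚ
      a₀≡0 with a₀ ℚ.≟ 0ℚ
      ... | yes a₀≡0 = a₀≡0
      ... | no  a₀≢0 = contradiction (Implies-resp e≡ (Implies-* (- w) tail∈L)) e∉L
        where
        instance _ = ℚ.≢-nonZero a₀≢0
        w = 1/ a₀
        open ≡-Reasoning
        e≡ : ∀ i → - w * tail i ≡ e i
        e≡ i = begin
          - w * tail i                             ≡⟨ solve 4 (λ w a e t → (:- w) :* t := (w :* a) :* e :- w :* (a :* e :+ t))
                                                        refl w a₀ (e i) (tail i) ⟩
          (w * a₀) * e i - w * (a₀ * e i + tail i) ≡⟨ cong₂ (λ u v → u * e i - w * v) (ℚₚ.*-inverseˡ a₀) (comb≡0 i) ⟩
          1ℚ * e i - w * 0ℚ                        ≡⟨ solve 2 (λ w e → con 1ℚ :* e :- w :* con 0ℚ := e) refl w (e i) ⟩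
          e i                                      ∎

      tail≡0 : ∀ i → tail i ≡ 0ℚ
      tail≡0 i = trans (sym (trans (cong (λ u → u * e i + tail i) a₀≡0)
                                   (solve 2 (λ x t → con 0ℚ :* x :+ t := t) refl (e i) (tail i))))
                       (comb≡0 i)

  -- Pairs of variables and the star

  ⌊2m/2⌋≡m : ∀ m → ⌊ 2 ℕ.* m /2⌋ ≡ m
  ⌊2m/2⌋≡m zero    = refl
  ⌊2m/2⌋≡m (suc m) rewrite ℕₚ.*-suc 2 m = cong suc (⌊2m/2⌋≡m m)

  ⌊1+2m/2⌋≡m : ∀ m → ⌊ suc (2 ℕ.* m) /2⌋ ≡ m
  ⌊1+2m/2⌋≡m zero    = refl
  ⌊1+2m/2⌋≡m (suc m) = trans (cong (λ n → ⌊ suc n /2⌋) (ℕₚ.*-suc 2 m)) (cong suc (⌊1+2m/2⌋≡m m))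

  even⊎odd : ∀ n → n ≡ 2 ℕ.* ⌊ n /2⌋ ⊎ n ≡ suc (2 ℕ.* ⌊ n /2⌋)
  even⊎odd zero          = inj₁ refl
  even⊎odd (suc zero)    = inj₂ refl
  even⊎odd (suc (suc n)) rewrite ℕₚ.*-suc 2 ⌊ n /2⌋ with even⊎odd n
  ... | inj₁ n≡ = inj₁ (cong (suc ∘′ suc) n≡)
  ... | inj₂ n≡ = inj₂ (cong (suc ∘′ suc) n≡)

  ⌊n/2⌋<p : ∀ {n p} → n ℕ.< 2 ℕ.* p → ⌊ n /2⌋ ℕ.< p
  ⌊n/2⌋<p {n} {p} n<2p = ℕₚ.*-cancelˡ-< 2 ⌊ n /2⌋ p (ℕₚ.≤-<-trans 2⌊n/2⌋≤n n<2p)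
    where
    2⌊n/2⌋≤n : 2 ℕ.* ⌊ n /2⌋ ℕ.≤ n
    2⌊n/2⌋≤n = [ ℕₚ.≤-reflexive ∘ sym , ℕₚ.≤-trans (ℕₚ.n≤1+n _) ∘ ℕₚ.≤-reflexive ∘ sym ]′ (even⊎odd n)

  -- `does` rather than `⌊_⌋`, so that `δℕ (suc x) (suc y)` reduces to `δℕ x y`.
  δℕ : ℕ → ℕ → ℚ
  δℕ x y = if does (x ≟ y) then 1ℚ else 0ℚ

  δℕ-≡ : ∀ {x y} → x ≡ y → δℕ x y ≡ 1ℚ
  δℕ-≡ {x} {y} x≡y = cong (if_then 1ℚ else 0ℚ) (dec-true (x ≟ y) x≡y)

  δℕ-≢ : ∀ {x y} → x ≢ y → δℕ x y ≡ 0ℚ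
  δℕ-≢ {x} {y} x≢y = cong (if_then 1ℚ else 0ℚ) (dec-false (x ≟ y) x≢y)

  Σᶠ-select : ∀ n (g : Fin n → ℚ) (t : Fin n) → Σᶠ n (λ m → g m * δℕ (toℕ t) (toℕ m)) ≡ g t
  Σᶠ-select (suc n) g Fin.zero = begin
    g Fin.zero * 1ℚ + Σᶠ n (λ m → g (Fin.suc m) * 0ℚ)
      ≡⟨ cong₂ _+_ (ℚₚ.*-identityʳ (g Fin.zero)) (trans (Σᶠ-cong n (λ m → ℚₚ.*-zeroʳ (g (Fin.suc m)))) (Σᶠ-0 n)) ⟩
    g Fin.zero + 0ℚ
      ≡⟨ ℚₚ.+-identityʳ (g Fin.zero) ⟩
    g Fin.zero ∎
    where open ≡-Reasoning
  Σᶠ-select (suc n) g (Fin.suc t) =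
    trans (cong₂ _+_ (ℚₚ.*-zeroʳ (g Fin.zero)) (Σᶠ-select n (g ∘ Fin.suc) t)) (ℚₚ.+-identityˡ (g (Fin.suc t)))

  Σᶠ-select-≥ : ∀ n (g : Fin n → ℚ) {x} → n ℕ.≤ x → Σᶠ n (λ m → g m * δℕ x (toℕ m)) ≡ 0ℚ
  Σᶠ-select-≥ zero    g         _         = refl
  Σᶠ-select-≥ (suc n) g {suc x} (s≤s n≤x) =
    trans (cong₂ _+_ (ℚₚ.*-zeroʳ (g Fin.zero)) (Σᶠ-select-≥ n (g ∘ Fin.suc) n≤x)) (ℚₚ.+-identityˡ 0ℚ)

  -- The variables x_{2m+1}, x_{2m+2} (indices 2m, 2m+1) form pair m; `pair m` is x_{2m+1} + x_{2m+2}.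
  pairOf : ∀ {k} → Fin k → ℕ
  pairOf i = ⌊ toℕ i /2⌋

  pair : ∀ {k} → ℕ → Content k
  pair m i = δℕ (pairOf i) m

  pairDiff : ∀ {k} → ℕ → ℕ → Content k
  pairDiff m j i = pair m i - pair j i

  pair-rep : ∀ {k m} → 2 ℕ.* m ℕ.< k → Σ (Fin k) λ i → pairOf i ≡ m
  pair-rep {m = m} 2m<k = fromℕ< 2m<k , trans (cong ⌊_/2⌋ (Finₚ.toℕ-fromℕ< 2m<k)) (⌊2m/2⌋≡m m)

  pair-vars : ∀ {k m} {i : Fin k} → Contains (pair m) i → pairOf i ≡ m
  pair-vars {m = m} {i} i∈ = decidable-stable (pairOf i ≟ m) (i∈ ∘ δℕ-≢)

  pairDiff-off : ∀ {k m j} {i : Fin k} → pairOf i ≢ m → pairOf i ≢ j → pairDiff m j i ≡ 0ℚ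
  pairDiff-off i∉m i∉j = trans (cong₂ _-_ (δℕ-≢ i∉m) (δℕ-≢ i∉j)) refl

  pairDiff-vars : ∀ {k m j} {i : Fin k} → Contains (pairDiff m j) i → pairOf i ≡ m ⊎ pairOf i ≡ j
  pairDiff-vars {m = m} {j} {i} i∈ with pairOf i ≟ m | pairOf i ≟ j
  ... | yes i∈m | _       = inj₁ i∈m
  ... | no _    | yes i∈j = inj₂ i∈j
  ... | no i∉m  | no i∉j  = ⊥-elim (i∈ (pairDiff-off i∉m i∉j))

  pairDiffs-agree : ∀ {k j} {x y : Fin k} → pairOf x ≡ pairOf y →
                    ∀ M → All (λ l → l x ≡ l y) (map (λ m → pairDiff m j) M)
  pairDiffs-agree         same []      = []
  pairDiffs-agree {j = j} same (m ∷ M) = cong (λ q → δℕ q m - δℕ q j) same ∷ pairDiffs-agree same M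

  pairDiffs-independent : ∀ {k j} {M : List ℕ} → Unique M → All (λ m → m ≢ j × 2 ℕ.* m ℕ.< k) M →
                          Independent (map (λ m → pairDiff {k} m j) M)
  pairDiffs-independent []                 []                   = λ _ _ ()
  pairDiffs-independent {k} {j} {m ∷ M} (m∉M ∷ M!) ((m≢j , 2m<k) ∷ M-ok) =
    Independent-∷ {L = map (λ m′ → pairDiff m′ j) M} not-implied (pairDiffs-independent M! M-ok)
    where
    i = proj₁ (pair-rep {k} {m} 2m<k)
    i∈m = proj₂ (pair-rep {k} {m} 2m<k)
    i∉j : pairOf i ≢ j
    i∉j = m≢j ∘ trans (sym i∈m)
    others-vanish : ∀ {M′} → All (m ≢_) M′ → All (λ l → l i ≡ 0ℚ) (map (λ m′ → pairDiff m′ j) M′)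
    others-vanish []            = []
    others-vanish (m≢m′ ∷ m∉M′) = pairDiff-off (m≢m′ ∘ trans (sym i∈m)) i∉j ∷ others-vanish m∉M′
    not-implied : ¬ Implies (map (λ m′ → pairDiff m′ j) M) (pairDiff m j)
    not-implied implied = ℚₚ.1≢0 (trans (sym (trans (cong₂ _-_ (δℕ-≡ i∈m) (δℕ-≢ i∉j)) refl))
                                        (Implies-vanish (others-vanish m∉M) implied))

  δℕ-step-at : ∀ {x j} → x ≡ j → δℕ x j - δℕ x (suc j) ≡ 1ℚ
  δℕ-step-at {j = j} refl = trans (cong₂ _-_ (δℕ-≡ {j} refl) (δℕ-≢ {j} (ℕₚ.1+n≢n ∘ sym))) refl

  δℕ-step-after : ∀ {x j} → x ≡ suc j → δℕ x j - δℕ x (suc j) ≡ - 1ℚ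
  δℕ-step-after {j = j} refl = trans (cong₂ _-_ (δℕ-≢ {suc j} ℕₚ.1+n≢n) (δℕ-≡ {suc j} refl)) refl

  starCoef≡δℕ-δℕ : ∀ j n → starCoef j n ≡ δℕ ⌊ n /2⌋ j - δℕ ⌊ n /2⌋ (suc j)
  starCoef≡δℕ-δℕ j n with n ≟ 2 ℕ.* j | n ≟ suc (2 ℕ.* j) | n ≟ 2 ℕ.+ 2 ℕ.* j | n ≟ 3 ℕ.+ 2 ℕ.* j
  ... | yes refl | _        | _        | _        = sym (δℕ-step-at (⌊2m/2⌋≡m j))
  ... | no _     | yes refl | _        | _        = sym (δℕ-step-at (⌊1+2m/2⌋≡m j))
  ... | no _     | no _     | yes refl | _        = sym (δℕ-step-after (cong suc (⌊2m/2⌋≡m j)))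
  ... | no _     | no _     | no _     | yes refl = sym (δℕ-step-after (cong suc (⌊1+2m/2⌋≡m j)))
  ... | no ≢0    | no ≢1    | no ≢2    | no ≢3    = sym (cong₂ _-_ (δℕ-≢ ≢j) (δℕ-≢ ≢1+j))
    where
    ≢j : ⌊ n /2⌋ ≢ j
    ≢j eq = [ (λ e → ≢0 (trans e (cong (2 ℕ.*_) eq))) , (λ e → ≢1 (trans e (cong (suc ∘ (2 ℕ.*_)) eq))) ]′ (even⊎odd n)
    ≢1+j : ⌊ n /2⌋ ≢ suc j
    ≢1+j eq = [ (λ e → ≢2 (trans e (trans (cong (2 ℕ.*_) eq) (ℕₚ.*-suc 2 j))))
              , (λ e → ≢3 (trans e (cong suc (trans (cong (2 ℕ.*_) eq) (ℕₚ.*-suc 2 j))))) ]′ (even⊎odd n)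

  starEq : ∀ {k} → ℕ → Content k
  starEq j i = starCoef j (toℕ i)

  starEq∈star : ∀ {k p j} → suc j ℕ.< p → starEq {k} j ∈ star p
  starEq∈star lt = ∈-map⁺ _ (∈-upTo⁺ (ℕₚ.∸-monoˡ-≤ 1 lt))

  module _ {k p : ℕ} {L : List (Content k)} (star⊆L : All (Implies L) (star p)) where

    open Span L

    star⇒pairDiff₀ : ∀ {m} → m ℕ.< p → Implies L (pairDiff m 0)
    star⇒pairDiff₀ {zero}  _   = Implies-resp (λ i → sym (ℚₚ.+-inverseʳ (pair 0 i))) Implies-0
    star⇒pairDiff₀ {suc m} m<p = Implies-resp telescope
      (Implies-− (star⇒pairDiff₀ (ℕₚ.<-trans (ℕₚ.n<1+n m) m<p)) (All.lookup star⊆L (starEq∈star m<p)))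
      where
      telescope : ∀ i → pairDiff m 0 i - starEq m i ≡ pairDiff (suc m) 0 i
      telescope i rewrite starCoef≡δℕ-δℕ m (toℕ i) =
        solve 3 (λ a b c → (a :- c) :- (a :- b) := b :- c) refl (pair m i) (pair (suc m) i) (pair 0 i)

    star⇒pairDiff : ∀ {m j} → m ℕ.< p → j ℕ.< p → Implies L (pairDiff m j)
    star⇒pairDiff {m} {j} m<p j<p = Implies-resp
      (λ i → solve 3 (λ a b c → (a :- c) :- (b :- c) := a :- b) refl (pair m i) (pair j i) (pair 0 i))
      (Implies-− (star⇒pairDiff₀ m<p) (star⇒pairDiff₀ j<p))

  -- Counting variables

  countᶠ-false : ∀ n → countᶠ n (λ _ → false) ≡ 0
  countᶠ-false zero    = refl
  countᶠ-false (suc n) = countᶠ-false n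

  countᶠ-mono : ∀ n {f g : Fin n → Bool} → (∀ i → T (f i) → T (g i)) → countᶠ n f ℕ.≤ countᶠ n g
  countᶠ-mono zero    f⇒g = z≤n
  countᶠ-mono (suc n) {f} {g} f⇒g with f Fin.zero | g Fin.zero | f⇒g Fin.zero
  ... | true  | true  | _   = s≤s (countᶠ-mono n (f⇒g ∘ Fin.suc))
  ... | true  | false | f⇒⊥ = ⊥-elim (f⇒⊥ _)
  ... | false | true  | _   = ℕₚ.m≤n⇒m≤1+n (countᶠ-mono n (f⇒g ∘ Fin.suc))
  ... | false | false | _   = countᶠ-mono n (f⇒g ∘ Fin.suc)

  countᶠ-∨ : ∀ n (f g : Fin n → Bool) → countᶠ n (λ i → f i ∨ g i) ℕ.≤ countᶠ n f ℕ.+ countᶠ n g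
  countᶠ-∨ zero    f g = z≤n
  countᶠ-∨ (suc n) f g with f Fin.zero | g Fin.zero | countᶠ-∨ n (f ∘ Fin.suc) (g ∘ Fin.suc)
  ... | true  | true  | ih = s≤s (ℕₚ.≤-trans ih (ℕₚ.+-monoʳ-≤ (countᶠ n (f ∘ Fin.suc)) (ℕₚ.n≤1+n _)))
  ... | true  | false | ih = s≤s ih
  ... | false | true  | ih = ℕₚ.≤-trans (s≤s ih) (ℕₚ.≤-reflexive (sym (ℕₚ.+-suc _ _)))
  ... | false | false | ih = ih

  countᶠ-pair : ∀ n m → countᶠ n (λ i → does (pairOf i ≟ m)) ℕ.≤ 2
  countᶠ-pair zero          m       = z≤n
  countᶠ-pair (suc zero)    zero    = s≤s z≤n
  countᶠ-pair (suc zero)    (suc m) = z≤n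
  countᶠ-pair (suc (suc n)) zero    = ℕₚ.≤-reflexive (cong (2 ℕ.+_) (countᶠ-false n))
  countᶠ-pair (suc (suc n)) (suc m) = countᶠ-pair n m

  countᶠ-pairs : ∀ n (M : List ℕ) → countᶠ n (λ i → does (pairOf i ∈? M)) ℕ.≤ 2 ℕ.* length M
  countᶠ-pairs n []      = ℕₚ.≤-reflexive (countᶠ-false n)
  countᶠ-pairs n (m ∷ M) = ℕₚ.≤-trans (countᶠ-∨ n _ _)
    (ℕₚ.≤-trans (ℕₚ.+-mono-≤ (countᶠ-pair n m) (countᶠ-pairs n M)) (ℕₚ.≤-reflexive (sym (ℕₚ.*-suc 2 (length M)))))

  -- `numVars` tests for a nonzero coefficient with a helper local to its definition, which
  -- unfolds to `any` only along a list whose spine is known, hence the bound on the length.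
  numVars≡countᶠ-any : ∀ {k} (E : List (Content k)) → length E ℕ.≤ 9 →
                       numVars E ≡ countᶠ k (λ i → any (λ e → not ⌊ e i ℚ.≟ 0ℚ ⌋) E)
  numVars≡countᶠ-any []                                    _ = refl
  numVars≡countᶠ-any (_ ∷ [])                              _ = refl
  numVars≡countᶠ-any (_ ∷ _ ∷ [])                          _ = refl
  numVars≡countᶠ-any (_ ∷ _ ∷ _ ∷ [])                      _ = refl
  numVars≡countᶠ-any (_ ∷ _ ∷ _ ∷ _ ∷ [])                  _ = refl
  numVars≡countᶠ-any (_ ∷ _ ∷ _ ∷ _ ∷ _ ∷ [])              _ = refl
  numVars≡countᶠ-any (_ ∷ _ ∷ _ ∷ _ ∷ _ ∷ _ ∷ [])          _ = refl
  numVars≡countᶠ-any (_ ∷ _ ∷ _ ∷ _ ∷ _ ∷ _ ∷ _ ∷ [])      _ = refl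
  numVars≡countᶠ-any (_ ∷ _ ∷ _ ∷ _ ∷ _ ∷ _ ∷ _ ∷ _ ∷ [])  _ = refl
  numVars≡countᶠ-any (_ ∷ _ ∷ _ ∷ _ ∷ _ ∷ _ ∷ _ ∷ _ ∷ _ ∷ []) _ = refl
  numVars≡countᶠ-any (_ ∷ _ ∷ _ ∷ _ ∷ _ ∷ _ ∷ _ ∷ _ ∷ _ ∷ _ ∷ _)
    (s≤s (s≤s (s≤s (s≤s (s≤s (s≤s (s≤s (s≤s (s≤s ())))))))))

  numVars-≤-pairs : ∀ {k} (E : List (Content k)) (M : List ℕ) → length E ℕ.≤ 9 →
                    All (λ e → ∀ i → Contains e i → pairOf i ∈ M) E → numVars E ℕ.≤ 2 ℕ.* length M
  numVars-≤-pairs {k} E M |E|≤9 E⊆M = begin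
    numVars E                                          ≡⟨ numVars≡countᶠ-any E |E|≤9 ⟩
    countᶠ k (λ i → any (λ e → not ⌊ e i ℚ.≟ 0ℚ ⌋) E) ≤⟨ countᶠ-mono k var⇒pair ⟩
    countᶠ k (λ i → does (pairOf i ∈? M))             ≤⟨ countᶠ-pairs k M ⟩
    2 ℕ.* length M                                     ∎
    where
    open ℕₚ.≤-Reasoning
    var⇒pair : ∀ i → T (any (λ e → not ⌊ e i ℚ.≟ 0ℚ ⌋) E) → T (does (pairOf i ∈? M))
    var⇒pair i used with All.lookupAny E⊆M (any⁻ _ E used)
    ... | e⊆M , ei≢0 = Equivalence.from T-≡ (dec-true (pairOf i ∈? M) (e⊆M i (toWitnessFalse ei≢0)))

  -- Lightness

  ℕtoℚ≡mkℚ : ∀ n → ℕtoℚ n ≡ mkℚ (ℤ.+ n) 0 (Coprime.sym (1-coprimeTo n))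
  ℕtoℚ≡mkℚ n = ℚₚ.normalize-coprime (Coprime.sym (1-coprimeTo n))

  ℕtoℚ-+ : ∀ m n → ℕtoℚ (m ℕ.+ n) ≡ ℕtoℚ m + ℕtoℚ n
  ℕtoℚ-+ m n = trans
    (cong (ℚ._/ 1) (sym (cong₂ ℤ._+_ (ℤₚ.*-identityʳ (ℤ.+ m)) (ℤₚ.*-identityʳ (ℤ.+ n)))))
    (sym (cong₂ _+_ (ℕtoℚ≡mkℚ m) (ℕtoℚ≡mkℚ n)))

  ℕtoℚ-mono : ∀ {m n} → m ℕ.≤ n → ℕtoℚ m ≤ ℕtoℚ n
  ℕtoℚ-mono {m} {n} m≤n rewrite ℕtoℚ≡mkℚ m | ℕtoℚ≡mkℚ n =
    *≤* (subst₂ ℤ._≤_ (sym (ℤₚ.*-identityʳ (ℤ.+ m))) (sym (ℤₚ.*-identityʳ (ℤ.+ n))) (ℤ.+≤+ m≤n))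

  ε²≤1 : ∀ {ε} → 0ℚ < ε → ε * ℕtoℚ 4096 ≤ 1ℚ → ε * ε ≤ 1ℚ
  ε²≤1 {ε} 0<ε ε*4096≤1 = begin
    ε * ε   ≤⟨ ℚₚ.*-monoˡ-≤-nonNeg ε ε≤1 ⟩
    ε * 1ℚ  ≡⟨ ℚₚ.*-identityʳ ε ⟩
    ε       ≤⟨ ε≤1 ⟩
    1ℚ      ∎
    where
    open ℚₚ.≤-Reasoning
    instance _ = ℚ.nonNegative (ℚₚ.<⇒≤ 0<ε)
    ε≤1 : ε ≤ 1ℚ
    ε≤1 = begin
      ε              ≡⟨ ℚₚ.*-identityʳ ε ⟨
      ε * 1ℚ         ≤⟨ ℚₚ.*-monoˡ-≤-nonNeg ε (ℕtoℚ-mono {1} {4096} (s≤s z≤n)) ⟩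
      ε * ℕtoℚ 4096  ≤⟨ ε*4096≤1 ⟩
      1ℚ             ∎

  c-near-2 : ∀ {ε k₀ c} → StandingParams ε k₀ c → (ℕtoℚ 2 - c) * ℕtoℚ 32 ≤ 1ℚ
  c-near-2 (0<ε , ε*4096≤1 , _ , [2-c]*32≤ε² , _) = ℚₚ.≤-trans [2-c]*32≤ε² (ε²≤1 0<ε ε*4096≤1)

  -- c t + 1 ≤ 2 t means (2 - c) t ≥ 1, so 32 ≤ 32 (2 - c) t ≤ t ≤ 9.
  no-room : ∀ {c t} → (ℕtoℚ 2 - c) * ℕtoℚ 32 ≤ 1ℚ → t ℕ.≤ 9 → c * ℕtoℚ t + 1ℚ ≤ ℕtoℚ (2 ℕ.* t) → ⊥
  no-room {c} {t} [2-c]*32≤1 t≤9 ct+1≤2t =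
    ℚₚ.<-irrefl refl (ℚₚ.≤-<-trans 32≤9 (toWitness {a? = ℕtoℚ 9 ℚₚ.<? ℕtoℚ 32} _))
    where
    open ℚₚ.≤-Reasoning
    u = ℕtoℚ 2 - c
    τ = ℕtoℚ t
    instance _ = ℚ.nonNegative (ℕtoℚ-mono {0} {t} z≤n)
    instance _ = ℚ.nonNegative (ℕtoℚ-mono {0} {32} z≤n)
    1≤uτ : 1ℚ ≤ u * τ
    1≤uτ = begin
      1ℚ                      ≡⟨ solve 2 (λ c τ → con 1ℚ := ((c :* τ) :+ con 1ℚ) :- c :* τ) refl c τ ⟩
      (c * τ + 1ℚ) - c * τ     ≤⟨ ℚₚ.+-monoˡ-≤ (- (c * τ)) ct+1≤2t ⟩
      ℕtoℚ (2 ℕ.* t) - c * τ   ≡⟨ cong (_- c * τ) (trans (cong (λ n → ℕtoℚ (t ℕ.+ n)) (ℕₚ.+-identityʳ t)) (ℕtoℚ-+ t t)) ⟩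
      (τ + τ) - c * τ          ≡⟨ solve 2 (λ c τ → (τ :+ τ) :- c :* τ := (con (ℕtoℚ 2) :- c) :* τ) refl c τ ⟩
      u * τ                    ∎
    32≤9 : ℕtoℚ 32 ≤ ℕtoℚ 9
    32≤9 = begin
      ℕtoℚ 32            ≡⟨ ℚₚ.*-identityˡ (ℕtoℚ 32) ⟨
      1ℚ * ℕtoℚ 32       ≤⟨ ℚₚ.*-monoʳ-≤-nonNeg (ℕtoℚ 32) 1≤uτ ⟩
      (u * τ) * ℕtoℚ 32  ≡⟨ solve 3 (λ u τ x → (u :* τ) :* x := (u :* x) :* τ) refl u τ (ℕtoℚ 32) ⟩
      (u * ℕtoℚ 32) * τ  ≤⟨ ℚₚ.*-monoʳ-≤-nonNeg τ [2-c]*32≤1 ⟩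
      1ℚ * τ             ≡⟨ ℚₚ.*-identityˡ τ ⟩
      τ                  ≤⟨ ℕtoℚ-mono t≤9 ⟩
      ℕtoℚ 9             ∎

  SmallSystemsSpread : ∀ {k} → List (Content k) → Set
  SmallSystemsSpread C = ∀ E → 1 ℕ.≤ length E → length E ℕ.≤ 9 → All (Implies C) E → Independent E →
                         2 ℕ.* length E ℕ.< numVars E

  light⇒spread : ∀ {ε k₀ c k} {C : List (Content k)} → StandingParams ε k₀ c → Light c C → SmallSystemsSpread C
  light⇒spread {c = c} params light E 1≤t t≤9 E⊆C indep = ℕₚ.≰⇒> λ n≤2t →
    no-room {c} {length E} (c-near-2 params) t≤9 (begin
      c * ℕtoℚ (length E) + 1ℚ ≤⟨ light E 1≤t E⊆C indep ⟩
      ℕtoℚ (numVars E)         ≤⟨ ℕtoℚ-mono n≤2t ⟩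
      ℕtoℚ (2 ℕ.* length E)    ∎)
    where open ℚₚ.≤-Reasoning

  -- Eliminating x_{2p+1}

  diffContent-vars : ∀ {k} {a b c d i : Fin k} → Contains (diffContent a b c d) i → i ∈ a ∷ b ∷ c ∷ d ∷ []
  diffContent-vars {a = a} {b} {c} {d} {i} i∈ with a Fin.≟ i | b Fin.≟ i | c Fin.≟ i | d Fin.≟ i
  ... | yes refl | _        | _        | _        = here refl
  ... | no _     | yes refl | _        | _        = there (here refl)
  ... | no _     | no _     | yes refl | _        = there (there (here refl))
  ... | no _     | no _     | no _     | yes refl = there (there (there (here refl)))
  ... | no _     | no _     | no _     | no _     = ⊥-elim (i∈ refl)

  diffVars : ∀ {k} {e : Content k} → IsDiffEq e → List (Fin k)
  diffVars (a , b , c , d , _) = a ∷ b ∷ c ∷ d ∷ []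

  diffVars-cover : ∀ {k} {e : Content k} (e-diff : IsDiffEq e) → ∀ i → Contains e i → i ∈ diffVars e-diff
  diffVars-cover (_ , _ , _ , _ , e≗ , _) i ei≢0 = diffContent-vars (ei≢0 ∘ trans (e≗ i))

  elim : ∀ {k} → Fin k → Content k → Content k → Content k
  elim x e d i = d x * e i - e x * d i

  module _ {k} {x : Fin k} {e d : Content k} where

    elim-at : elim x e d x ≡ 0ℚ
    elim-at = solve 2 (λ a b → b :* a :- a :* b := con 0ℚ) refl (e x) (d x)

    elim-vanish : ∀ {i} → e i ≡ 0ℚ → d i ≡ 0ℚ → elim x e d i ≡ 0ℚ
    elim-vanish ei≡0 di≡0 = trans (cong₂ (λ u v → d x * u - e x * v) ei≡0 di≡0)
      (solve 2 (λ a b → b :* con 0ℚ :- a :* con 0ℚ := con 0ℚ) refl (e x) (d x))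

    elim-vars : ∀ {i} → Contains (elim x e d) i → Contains e i ⊎ Contains d i
    elim-vars {i} i∈ with e i ℚ.≟ 0ℚ | d i ℚ.≟ 0ℚ
    ... | no ei≢0  | _        = inj₁ ei≢0
    ... | yes _    | no di≢0  = inj₂ di≢0
    ... | yes ei≡0 | yes di≡0 = ⊥-elim (i∈ (elim-vanish ei≡0 di≡0))

    elim-first : ∀ {m} → InFirst (m ℕ.+ 1) e → InFirst (m ℕ.+ 1) d → toℕ x ≡ m → InFirst m (elim x e d)
    elim-first {m} e-first d-first x≡m i m≤i with toℕ i ≟ m
    ... | yes i≡m = subst (λ y → elim x e d y ≡ 0ℚ) (Finₚ.toℕ-injective (trans x≡m (sym i≡m))) elim-at
    ... | no  i≢m = elim-vanish (e-first i m+1≤i) (d-first i m+1≤i)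
      where
      m+1≤i : m ℕ.+ 1 ℕ.≤ toℕ i
      m+1≤i = subst (ℕ._≤ toℕ i) (ℕₚ.+-comm 1 m) (ℕₚ.≤∧≢⇒< m≤i (i≢m ∘ sym))

    elim-implied : ∀ {L} → Implies L e → Implies L d → Implies L (elim x e d)
    elim-implied {L} e∈L d∈L = Span.Implies-− L (Span.Implies-* L (d x) e∈L) (Span.Implies-* L (e x) d∈L)

    elim-recover : .{{_ : ℚ.NonZero (e x)}} → ∀ i → 1/ e x * (d x * e i - elim x e d i) ≡ d i
    elim-recover i = begin
      1/ e x * (d x * e i - elim x e d i)
        ≡⟨ solve 5 (λ w a b u v → w :* (b :* u :- (b :* u :- a :* v)) := (w :* a) :* v) refl (1/ e x) (e x) (d x) (e i) (d i) ⟩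
      (1/ e x * e x) * d i  ≡⟨ cong (_* d i) (ℚₚ.*-inverseˡ (e x)) ⟩
      1ℚ * d i              ≡⟨ ℚₚ.*-identityˡ (d i) ⟩
      d i                   ∎
      where open ≡-Reasoning

  module _ {k p : ℕ} {C : List (Content k)} (spread : SmallSystemsSpread C) (2p<k : 2 ℕ.* p ℕ.< k)
           (star⊆C : All (Implies C) (star p)) {f : Content k} (f∈C : Implies C f)
           (f-first : InFirst (2 ℕ.* p) f) {S : List (Fin k)} (|S|≤8 : length S ℕ.≤ 8)
           (S-covers : ∀ i → Contains f i → i ∈ S) where

    private
      2m<k : ∀ {m} → m ℕ.< p → 2 ℕ.* m ℕ.< k
      2m<k m<p = ℕₚ.<-trans (ℕₚ.*-monoʳ-< 2 m<p) 2p<k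

      f-pair<p : ∀ {i} → Contains f i → pairOf i ℕ.< p
      f-pair<p {i} fi≢0 = ⌊n/2⌋<p (ℕₚ.≰⇒> (fi≢0 ∘ f-first i))

      otherPair? : ∀ j → Decidable (λ m → m ℕ.< p × m ≢ j)
      otherPair? j m = m ℕ.<? p ×-dec ¬? (m ≟ j)

      otherPairs : ℕ → List ℕ
      otherPairs j = deduplicate _≟_ (filter (otherPair? j) (map pairOf S))

      otherPairs-bounded : ∀ {j m} → m ∈ otherPairs j → m ℕ.< p × m ≢ j
      otherPairs-bounded {j} m∈ =
        proj₂ (∈-filter⁻ (otherPair? j) {xs = map pairOf S} (∈-deduplicate⁻ _≟_ (filter (otherPair? j) (map pairOf S)) m∈))

      otherPairs-cover : ∀ {j i} → Contains f i → pairOf i ≢ j → pairOf i ∈ otherPairs j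
      otherPairs-cover {j} {i} fi≢0 i∉j = ∈-deduplicate⁺ _≟_
        (∈-filter⁺ (otherPair? j) {xs = map pairOf S} (∈-map⁺ pairOf (S-covers i fi≢0)) (f-pair<p fi≢0 , i∉j))

      |otherPairs|≤8 : ∀ j → length (otherPairs j) ℕ.≤ 8
      |otherPairs|≤8 j = begin
        length (otherPairs j)                          ≤⟨ Listₚ.length-deduplicate _≟_ (filter (otherPair? j) (map pairOf S)) ⟩
        length (filter (otherPair? j) (map pairOf S))  ≤⟨ Listₚ.length-filter (otherPair? j) (map pairOf S) ⟩
        length (map pairOf S)                          ≡⟨ Listₚ.length-map pairOf S ⟩
        length S                                       ≤⟨ |S|≤8 ⟩
        8                                              ∎
        where open ℕₚ.≤-Reasoning

    split-pair⇒⊥ : ∀ {i i′} → pairOf i ≡ pairOf i′ → f i ≢ f i′ → ⊥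
    split-pair⇒⊥ {i} {i′} same fi≢fi′ = ℕₚ.<⇒≱ (spread E (s≤s z≤n) |E|≤9 E⊆C E-independent) E-vars
      where
      j = pairOf i
      j<p : j ℕ.< p
      j<p with f i ℚ.≟ 0ℚ
      ... | no  fi≢0 = f-pair<p fi≢0
      ... | yes fi≡0 = subst (ℕ._< p) (sym same) (f-pair<p (fi≢fi′ ∘ trans fi≡0 ∘ sym))
      Js = otherPairs j
      diffs = map (λ m → pairDiff m j) Js
      E = f ∷ diffs
      |E|≡ : length E ≡ suc (length Js)
      |E|≡ = cong suc (Listₚ.length-map (λ m → pairDiff m j) Js)
      |E|≤9 : length E ℕ.≤ 9
      |E|≤9 = subst (ℕ._≤ 9) (sym |E|≡) (s≤s (|otherPairs|≤8 j))
      E⊆C : All (Implies C) E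
      E⊆C = f∈C ∷ Allₚ.map⁺ (All.tabulate λ m∈Js → star⇒pairDiff {L = C} star⊆C (proj₁ (otherPairs-bounded m∈Js)) j<p)
      E-independent : Independent E
      E-independent = Independent-∷ {L = diffs}
        (λ f∈diffs → fi≢fi′ (Implies-agree (pairDiffs-agree same Js) f∈diffs))
        (pairDiffs-independent (deduplicate-! _) (All.tabulate λ m∈Js →
          let (m<p , m≢j) = otherPairs-bounded m∈Js in m≢j , 2m<k m<p))
      f-vars : ∀ x → Contains f x → pairOf x ∈ j ∷ Js
      f-vars x fx≢0 with pairOf x ≟ j
      ... | yes x∈j = here x∈j
      ... | no  x∉j = there (otherPairs-cover fx≢0 x∉j)
      diff-vars : All (λ m → ∀ x → Contains (pairDiff m j) x → pairOf x ∈ j ∷ Js) Js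
      diff-vars = All.tabulate λ m∈Js x x∈ → [ (λ x∈m → there (subst (_∈ Js) (sym x∈m) m∈Js)) , here ]′ (pairDiff-vars x∈)
      E-vars : numVars E ℕ.≤ 2 ℕ.* length E
      E-vars = subst (λ n → numVars E ℕ.≤ 2 ℕ.* n) (sym |E|≡)
        (numVars-≤-pairs E (j ∷ Js) |E|≤9 (f-vars ∷ Allₚ.map⁺ diff-vars))

    private
      pairConstant : ∀ i i′ → pairOf i ≡ pairOf i′ → f i ≡ f i′
      pairConstant i i′ same = decidable-stable (f i ℚ.≟ f i′) (split-pair⇒⊥ same)

      rep : Fin p → Fin k
      rep m = proj₁ (pair-rep {k} {toℕ m} (2m<k (Finₚ.toℕ<n m)))

      rep-pair : ∀ m → pairOf (rep m) ≡ toℕ m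
      rep-pair m = proj₂ (pair-rep {k} {toℕ m} (2m<k (Finₚ.toℕ<n m)))

      weight : Fin p → ℚ
      weight m = f (rep m)

      total : ℚ
      total = Σᶠ p weight

      pairPart : Content k
      pairPart i = Σᶠ p (λ m → weight m * pairDiff (toℕ m) 0 i)

      pairPart-implied : ∀ {L} → All (Implies L) (star p) → Implies L pairPart
      pairPart-implied {L} star⊆L =
        Span.Implies-Σᶠ L p λ m → Span.Implies-* L (weight m) (star⇒pairDiff₀ {L = L} star⊆L (Finₚ.toℕ<n m))

      f-by-pairs : ∀ i → f i ≡ Σᶠ p (λ m → weight m * pair (toℕ m) i)
      f-by-pairs i with pairOf i ℕ.<? p
      ... | yes i<p = sym (begin
        Σᶠ p (λ m → weight m * δℕ (pairOf i) (toℕ m))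
          ≡⟨ cong (λ x → Σᶠ p (λ m → weight m * δℕ x (toℕ m))) (sym (Finₚ.toℕ-fromℕ< i<p)) ⟩
        Σᶠ p (λ m → weight m * δℕ (toℕ (fromℕ< i<p)) (toℕ m))
          ≡⟨ Σᶠ-select p weight (fromℕ< i<p) ⟩
        f (rep (fromℕ< i<p))
          ≡⟨ pairConstant _ i (trans (rep-pair (fromℕ< i<p)) (Finₚ.toℕ-fromℕ< i<p)) ⟩
        f i ∎)
        where open ≡-Reasoning
      ... | no  i≮p = trans (f-first i (ℕₚ.≮⇒≥ (i≮p ∘ ⌊n/2⌋<p))) (sym (Σᶠ-select-≥ p weight (ℕₚ.≮⇒≥ i≮p)))

      f≡pairPart+total : ∀ i → f i ≡ pairPart i + total * pair 0 i
      f≡pairPart+total i = begin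
        f i                                                          ≡⟨ f-by-pairs i ⟩
        Σᶠ p (λ m → weight m * pair (toℕ m) i)                       ≡⟨ Σᶠ-cong p split ⟩
        Σᶠ p (λ m → weight m * pairDiff (toℕ m) 0 i + weight m * pair 0 i)
                                                                     ≡⟨ Σᶠ-+ p _ _ ⟩
        pairPart i + Σᶠ p (λ m → weight m * pair 0 i)                ≡⟨ cong (pairPart i +_) (Σᶠ-*ʳ p (pair 0 i) weight) ⟩
        pairPart i + total * pair 0 i                                ∎
        where
        open ≡-Reasoning
        split : ∀ m → weight m * pair (toℕ m) i ≡ weight m * pairDiff (toℕ m) 0 i + weight m * pair 0 i
        split m = solve 3 (λ w a b → w :* a := w :* (a :- b) :+ w :* b) refl (weight m) (pair (toℕ m) i) (pair 0 i)

      total≡0 : total ≡ 0ℚ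
      total≡0 = decidable-stable (total ℚ.≟ 0ℚ) λ total≢0 →
        ℕₚ.<⇒≱ (spread (pair₀ ∷ []) (s≤s z≤n) (s≤s z≤n) (pair₀-implied total≢0 ∷ []) pair₀-independent)
               (numVars-≤-pairs (pair₀ ∷ []) (0 ∷ []) (s≤s z≤n) ((λ i i∈ → here (pair-vars i∈)) ∷ []))
        where
        pair₀ : Content k
        pair₀ = pair 0
        pair₀-implied : total ≢ 0ℚ → Implies C pair₀
        pair₀-implied total≢0 = Span.Implies-resp C pair₀≡
          (Span.Implies-* C (1/ total) (Span.Implies-− C f∈C (pairPart-implied {C} star⊆C)))
          where
          instance _ = ℚ.≢-nonZero total≢0
          pair₀≡ : ∀ i → 1/ total * (f i - pairPart i) ≡ pair 0 i
          pair₀≡ i = begin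
            1/ total * (f i - pairPart i)                    ≡⟨ cong (λ x → 1/ total * (x - pairPart i)) (f≡pairPart+total i) ⟩
            1/ total * ((pairPart i + total * pair 0 i) - pairPart i)
              ≡⟨ solve 4 (λ w r t x → w :* ((r :+ t :* x) :- r) := (w :* t) :* x) refl (1/ total) (pairPart i) total (pair 0 i) ⟩
            (1/ total * total) * pair 0 i                    ≡⟨ cong (_* pair 0 i) (ℚₚ.*-inverseˡ total) ⟩
            1ℚ * pair 0 i                                    ≡⟨ ℚₚ.*-identityˡ (pair 0 i) ⟩
            pair 0 i                                         ∎
            where open ≡-Reasoning
        pair₀-independent : Independent (pair₀ ∷ [])
        pair₀-independent = Independent-∷ {L = []}
          (λ implied → ℚₚ.1≢0 (trans (sym (δℕ-≡ x₀∈0)) (Implies-vanish {L = []} {x = x₀} [] implied)))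
          (λ _ _ ())
          where
          x₀ = proj₁ (pair-rep {k} {0} (ℕₚ.≤-<-trans z≤n 2p<k))
          x₀∈0 = proj₂ (pair-rep {k} {0} (ℕₚ.≤-<-trans z≤n 2p<k))

    star-implies-sparse : Implies (star p) f
    star-implies-sparse = Span.Implies-resp (star p) (λ i → sym (trans (f≡pairPart+total i) (vanish i)))
      (pairPart-implied {star p} (All.tabulate Implies-∈))
      where
      vanish : ∀ i → pairPart i + total * pair 0 i ≡ pairPart i
      vanish i = trans (cong (λ t → pairPart i + t * pair 0 i) total≡0)
                       (solve 2 (λ r x → r :+ con 0ℚ :* x := r) refl (pairPart i) (pair 0 i))

  e∷star-implies : ∀ {k p} {C : List (Content k)} {e d : Content k} {x : Fin k} →
    SmallSystemsSpread C → 2 ℕ.* p ℕ.+ 1 ℕ.≤ k → All (Implies C) (star p) →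
    IsDiffEq e → InFirst (2 ℕ.* p ℕ.+ 1) e → Implies C e →
    IsDiffEq d → InFirst (2 ℕ.* p ℕ.+ 1) d → Implies C d →
    toℕ x ≡ 2 ℕ.* p → Contains e x → Implies (e ∷ star p) d
  e∷star-implies {k} {p} {C} {e} {d} {x} spread 2p+1≤k star⊆C e-diff e-first e∈C d-diff d-first d∈C x≡2p ex≢0 =
    Span.Implies-resp L (elim-recover {e = e})
      (Span.Implies-* L (1/ e x) (Span.Implies-− L (Span.Implies-* L (d x) (Implies-here {L = star p}))
                                                    (Implies-∷ {L = star p} f∈star)))
    where
    instance _ = ℚ.≢-nonZero ex≢0
    L = e ∷ star p
    S = diffVars e-diff ++ diffVars d-diff
    S-cover : ∀ i → Contains (elim x e d) i → i ∈ S
    S-cover i i∈ = [ ∈-++⁺ˡ ∘ diffVars-cover e-diff i , ∈-++⁺ʳ (diffVars e-diff) ∘ diffVars-cover d-diff i ]′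
                     (elim-vars {x = x} {e} {d} i∈)
    f∈star : Implies (star p) (elim x e d)
    f∈star = star-implies-sparse {k} {p} {C} spread (subst (ℕ._≤ k) (ℕₚ.+-comm (2 ℕ.* p) 1) 2p+1≤k) star⊆C
               (elim-implied {x = x} {e} {d} {C} e∈C d∈C) (elim-first {x = x} {e} {d} e-first d-first x≡2p)
               {S} ℕₚ.≤-refl S-cover

open import Data.Nat using (ℕ; _≤_; _+_; _*_)
open import Data.Rational using (ℚ)
open import Data.List using (_∷_)
open import Data.List.Relation.Unary.All using (All)
open import Data.Product using (_,_; _×_; proj₁)

lemma9p2 : (ε k₀ c : ℚ) → StandingParams ε k₀ c →
    (k : ℕ) → 1 ≤ k → (𝒞 : Configuration k) → Good c 𝒞 →
    (p : ℕ) → 2 * p + 1 ≤ k →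
    All (Implies (proj₁ 𝒞)) (star p) →
    (e⋆ : Content k) → IsDiffEq e⋆ → InFirst (2 * p + 1) e⋆ → ContainsIdx (2 * p) e⋆ →
    Implies (proj₁ 𝒞) e⋆ →
    (d : Content k) → IsDiffEq d → InFirst (2 * p + 1) d → ContainsIdx (2 * p) d →
    Implies (proj₁ 𝒞) d →
    Implies (e⋆ ∷ star p) d
lemma9p2 ε k₀ c params k _ (C , _) (_ , _ , light) p 2p+1≤k star⊆C
         e⋆ e⋆-diff e⋆-first (x , x≡2p , e⋆x≢0) e⋆∈C d d-diff d-first _ d∈C =
  e∷star-implies {k} {p} {C} {e⋆} {d} {x} (light⇒spread {ε} {k₀} {c} {k} {C} params light) 2p+1≤k star⊆C
    e⋆-diff e⋆-first e⋆∈C d-diff d-first d∈C x≡2p e⋆x≢0
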